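{- Let $G$ be the graph obtained from the $3$-dimensional hypercube $Q_3$ (vertex set $\{0,1\}^3$, two vertices adjacent iff they differ in exactly one coordinate) by adding a new vertex $r$ adjacent only to $u=(0,0,0)$; $G$ is rooted at $r$. Let $w$ be the weight function on $G$ with $w(r)=0$, $w(u)=4$, $w(x)=2$ for each $x\in\{(1,0,0),(0,1,0),(0,0,1)\}$, $w(y)=\tfrac43$ for each $y\in\{(1,1,0),(1,0,1),(0,1,1)\}$, and $w(1,1,1)=1$. Then $w$ is a valid weight function on $G$ rooted at $r$.
   Context: A configuration on a graph $G$ is a function $p:V(G)\to\mathbb{N}\cup\{0\}$ ($p(v)$ is the number of pebbles on $v$). A pebbling move from a vertex $u$ to an adjacent vertex $v$ removes two pebbles from $u$ and places one pebble on $v$. For a root $r$, a configuration $p$ is $r$-solvable if some (possibly empty) sequence of pebbling moves starting from $p$ places at least one pebble on $r$; otherwise it is $r$-unsolvable. A weight function is a function $w:V(G)\to\mathbb{R}_{\ge 0}$, and the weight of a configuration is $w(p)=\sum_{v\in V(G)}p(v)w(v)$. $1_G$ denotes the configuration with exactly one pebble on every vertex of $G$, so $w(1_G)=\sum_{v\in V(G)}w(v)$. A weight function $w$ on $G$ rooted at $r$ is valid if $r$ is the only vertex with weight $0$ and every $r$-unsolvable configuration $p$ satisfies $w(p)\le w(1_G)$. -}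

module Defs where

open import Data.Bool using (Bool; true; false)
open import Data.Nat using (ℕ; _∸_; _+_; _≤_)
import Data.Nat as ℕ
open import Data.Integer using (+_)
open import Data.Rational using (ℚ; 0ℚ; _/_; _*_) renaming (_+_ to _+ℚ_; _≤_ to _≤ℚ_)
open import Data.List using (List; []; _∷_; foldr; map)
open import Data.Product using (Σ; _×_; _,_)
open import Data.Empty using (⊥)
open import Data.Unit using (⊤)
open import Relation.Nullary using (¬_; yes; no)
open import Relation.Binary.Definitions using (DecidableEquality)
open import Relation.Binary.PropositionalEquality using (_≡_; refl)

Config : Set → Set
Config V = V → ℕ

module Pebbling {V : Set} (_≟_ : DecidableEquality V) (Adj : V → V → Set) where

  move : Config V → V → V → Config V
  move p u v x with x ≟ u | x ≟ v
  ... | yes _ | _     = p x ∸ 2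
  ... | no _  | yes _ = p x + 1
  ... | no _  | no _  = p x

  data Reach : Config V → Config V → Set where
    done : ∀ {p} → Reach p p
    step : ∀ {p q} u v → Adj u v → 2 ≤ p u → Reach (move p u v) q → Reach p q

  Solvable : V → Config V → Set
  Solvable r p = Σ (Config V) λ q → Reach p q × (1 ≤ q r)

  -- weight of a configuration; vs lists every vertex of the graph exactly once
  weight : List V → (V → ℚ) → Config V → ℚ
  weight vs w p = foldr (λ x acc → ((+ p x) / 1) * w x +ℚ acc) 0ℚ vs

  oneG : Config V
  oneG _ = 1

  ValidWeight : List V → V → (V → ℚ) → Set
  ValidWeight vs r w =
    (∀ v → 0ℚ ≤ℚ w v) × (w r ≡ 0ℚ) × (∀ v → w v ≡ 0ℚ → v ≡ r) ×
    (∀ (p : Config V) → ¬ Solvable r p → weight vs w p ≤ℚ weight vs w oneG)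

data V : Set where
  r : V
  q : Bool → Bool → Bool → V

_≟B_ : DecidableEquality Bool
false ≟B false = yes refl
false ≟B true  = no λ ()
true  ≟B false = no λ ()
true  ≟B true  = yes refl

_≟V_ : DecidableEquality V
r ≟V r = yes refl
r ≟V q _ _ _ = no λ ()
q _ _ _ ≟V r = no λ ()
q a b c ≟V q a' b' c' with a ≟B a' | b ≟B b' | c ≟B c'
... | yes refl | yes refl | yes refl = yes refl
... | no ne | _ | _ = no λ { refl → ne refl }
... | yes _ | no ne | _ = no λ { refl → ne refl }
... | yes _ | yes _ | no ne = no λ { refl → ne refl }

diffB : Bool → Bool → ℕ
diffB false false = 0
diffB true  true  = 0
diffB _     _     = 1

Adj : V → V → Set
Adj r r = ⊥
Adj r (q a b c) = q a b c ≡ q false false false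
Adj (q a b c) r = q a b c ≡ q false false false
Adj (q a b c) (q a' b' c') = diffB a a' + diffB b b' + diffB c c' ≡ 1

allV : List V
allV = r
  ∷ q false false false ∷ q true false false ∷ q false true false ∷ q false false true
  ∷ q true true false ∷ q true false true ∷ q false true true ∷ q true true true ∷ []

ones : Bool → Bool → Bool → ℕ
ones a b c = b2n a + b2n b + b2n c
  where
  b2n : Bool → ℕ
  b2n false = 0
  b2n true  = 1

w : V → ℚ
w r = 0ℚ
w (q a b c) with ones a b c
... | 0 = + 4 / 1
... | 1 = + 2 / 1
... | 2 = + 4 / 3
... | _ = + 1 / 1

open Pebbling _≟V_ Adj public

{-# OPTIONS --safe #-}
-- Scaled by 3, w takes the integer values 12, 6, 4, 3 on the four levels of the cube, and
-- w(1_G) becomes 45; so it suffices that every configuration of scaled weight at least 46 is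
-- r-solvable.  Solvability is monotone in the configuration, and a vertex of scaled weight k
-- holding at least 48/k pebbles already carries weight 48, so we may cap the number of pebbles
-- at 4, 8, 12, 16 on the four levels.  The finitely many capped configurations are enumerated
-- coordinate by coordinate; a prefix that is solvable with the remaining coordinates set to 0
-- settles its whole subtree.  Solvability is witnessed by explicit move sequences, found by
-- pushing all pebbles down towards u level by level, and checked move by move.
module Submission where

open import Data.Bool using (Bool; true; false; T; _∧_; _∨_)
open import Data.Bool.ListAction using (all)
open import Data.Bool.Properties using (T-∨; T-≡)
open import Data.Fin using (Fin; zero; suc; #_)
open import Data.Integer as ℤ using (+_; +≤+)
import Data.Integer.Properties as ℤ
open import Data.List as List using (List; []; _∷_; _++_; _∷ʳ_; [_]; upTo; findᵇ)
open import Data.List.Membership.Propositional.Properties using (∈-upTo⁺)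
open import Data.List.Properties using (++-assoc; ++-identityʳ)
open import Data.List.Relation.Binary.Pointwise as Pointwise using (Pointwise; []; _∷_)
open import Data.List.Relation.Unary.All as All using (All; []; _∷_; all?)
open import Data.List.Relation.Unary.All.Properties using (all⁺)
open import Data.Maybe using (fromMaybe)
open import Data.Nat as ℕ using (ℕ; zero; suc; _+_; _*_; _∸_; _⊓_; _/_; _%_; _≡ᵇ_; _≤ᵇ_; _<ᵇ_; _≤_; _≤?_; z≤n; s≤s)
open import Data.Nat.Coprimality using (1-coprimeTo) renaming (sym to coprime-sym)
open import Data.Nat.ListAction using (sum)
open import Data.Nat.Properties
open import Data.Product using (Σ; _×_; _,_)
open import Data.Rational using (ℚ; mkℚ; 0ℚ; *≤*; Positive)
  renaming (_+_ to _+ℚ_; _*_ to _*ℚ_; _≤_ to _≤ℚ_; _/_ to _/ℚ_)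
import Data.Rational.Properties as ℚ
open import Data.Sum using (_⊎_; inj₁; inj₂; [_,_]′)
open import Data.Vec as Vec using (Vec; []; _∷_; lookup; _[_]≔_; toList; fromList)
open import Data.Vec.Properties using (lookup∘update; lookup∘update′; lookup-map)
open import Function using (_∘_)
open import Function.Bundles using (Equivalence)
open import Relation.Binary.Definitions using (Decidable; DecidableEquality)
open import Relation.Binary.PropositionalEquality
  using (_≡_; _≗_; refl; sym; trans; cong; cong₂; subst; subst₂; module ≡-Reasoning)
open import Relation.Nullary using (¬_; yes; no; does; contradiction)
open import Relation.Nullary.Decidable using (toWitness)

open import Defs using (Config; module Pebbling)

toℚ : ℕ → ℚ
toℚ n = + n /ℚ 1

toℚ-normal : ∀ n → toℚ n ≡ mkℚ (+ n) 0 (coprime-sym (1-coprimeTo n))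
toℚ-normal n = ℚ.normalize-coprime (coprime-sym (1-coprimeTo n))

toℚ-homo-+ : ∀ m n → toℚ m +ℚ toℚ n ≡ toℚ (m + n)
toℚ-homo-+ m n rewrite toℚ-normal m | toℚ-normal n =
  cong (_/ℚ 1) (trans (cong₂ ℤ._+_ (ℤ.*-identityʳ (+ m)) (ℤ.*-identityʳ (+ n))) (sym (ℤ.pos-+ m n)))

toℚ-homo-* : ∀ m n → toℚ m *ℚ toℚ n ≡ toℚ (m * n)
toℚ-homo-* m n rewrite toℚ-normal m | toℚ-normal n = cong (_/ℚ 1) (sym (ℤ.pos-* m n))

toℚ-mono-≤ : ∀ {m n} → m ≤ n → toℚ m ≤ℚ toℚ n
toℚ-mono-≤ {m} {n} m≤n rewrite toℚ-normal m | toℚ-normal n =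
  *≤* (subst₂ ℤ._≤_ (sym (ℤ.*-identityʳ (+ m))) (sym (ℤ.*-identityʳ (+ n))) (+≤+ m≤n))

module PebblingProperties {Vertex : Set} (_≟_ : DecidableEquality Vertex) (Edge : Vertex → Vertex → Set) where
  open Pebbling _≟_ Edge

  infix 4 _≤ᶜ_
  _≤ᶜ_ : Config Vertex → Config Vertex → Set
  p ≤ᶜ p′ = ∀ x → p x ≤ p′ x

  move-mono : ∀ {p p′} u v → p ≤ᶜ p′ → move p u v ≤ᶜ move p′ u v
  move-mono u v p≤p′ x with x ≟ u | x ≟ v
  ... | yes _ | _     = ∸-monoˡ-≤ 2 (p≤p′ x)
  ... | no _  | yes _ = +-monoˡ-≤ 1 (p≤p′ x)
  ... | no _  | no _  = p≤p′ x

  Reach-mono : ∀ {p p′ s} → p ≤ᶜ p′ → Reach p s → Σ (Config Vertex) λ s′ → Reach p′ s′ × s ≤ᶜ s′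
  Reach-mono p≤p′ done = _ , done , p≤p′
  Reach-mono p≤p′ (step u v uv 2≤pu rest) with Reach-mono (move-mono u v p≤p′) rest
  ... | s′ , rest′ , s≤s′ = s′ , step u v uv (≤-trans 2≤pu (p≤p′ u)) rest′ , s≤s′

  Solvable-mono : ∀ {t p p′} → p ≤ᶜ p′ → Solvable t p → Solvable t p′
  Solvable-mono {t} p≤p′ (s , reach , 1≤st) with Reach-mono p≤p′ reach
  ... | s′ , reach′ , s≤s′ = s′ , reach′ , ≤-trans 1≤st (s≤s′ t)

  weightℕ : List Vertex → (Vertex → ℕ) → Config Vertex → ℕ
  weightℕ vs k p = sum (List.map (λ x → p x * k x) vs)

  module _ (c : ℕ) {w : Vertex → ℚ} {k : Vertex → ℕ} (c*w≡k : ∀ x → toℚ c *ℚ w x ≡ toℚ (k x)) where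

    weight-scaled : ∀ vs p → toℚ c *ℚ weight vs w p ≡ toℚ (weightℕ vs k p)
    weight-scaled []       p = ℚ.*-zeroʳ (toℚ c)
    weight-scaled (x ∷ vs) p = begin
      toℚ c *ℚ (toℚ (p x) *ℚ w x +ℚ weight vs w p)
        ≡⟨ ℚ.*-distribˡ-+ (toℚ c) _ _ ⟩
      toℚ c *ℚ (toℚ (p x) *ℚ w x) +ℚ toℚ c *ℚ weight vs w p
        ≡⟨ cong₂ _+ℚ_ scaled-term (weight-scaled vs p) ⟩
      toℚ (p x * k x) +ℚ toℚ (weightℕ vs k p)
        ≡⟨ toℚ-homo-+ (p x * k x) (weightℕ vs k p) ⟩
      toℚ (weightℕ (x ∷ vs) k p) ∎
      where
      open ≡-Reasoning
      scaled-term : toℚ c *ℚ (toℚ (p x) *ℚ w x) ≡ toℚ (p x * k x)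
      scaled-term = begin
        toℚ c *ℚ (toℚ (p x) *ℚ w x) ≡⟨ ℚ.*-assoc (toℚ c) _ _ ⟨
        toℚ c *ℚ toℚ (p x) *ℚ w x   ≡⟨ cong (_*ℚ w x) (ℚ.*-comm (toℚ c) _) ⟩
        toℚ (p x) *ℚ toℚ c *ℚ w x   ≡⟨ ℚ.*-assoc (toℚ (p x)) _ _ ⟩
        toℚ (p x) *ℚ (toℚ c *ℚ w x) ≡⟨ cong (toℚ (p x) *ℚ_) (c*w≡k x) ⟩
        toℚ (p x) *ℚ toℚ (k x)      ≡⟨ toℚ-homo-* (p x) (k x) ⟩
        toℚ (p x * k x)             ∎

    weight-mono-scaled : .{{_ : Positive (toℚ c)}} → ∀ vs {p p′} →
                         weightℕ vs k p ≤ weightℕ vs k p′ → weight vs w p ≤ℚ weight vs w p′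
    weight-mono-scaled vs {p} {p′} le = ℚ.*-cancelˡ-≤-pos (toℚ c)
      (subst₂ _≤ℚ_ (sym (weight-scaled vs p)) (sym (weight-scaled vs p′)) (toℚ-mono-≤ le))

  -- A summand that gets capped is by itself at least t.
  weightℕ-⊓ : ∀ {k cap : Vertex → ℕ} {t s} vs p → All (λ x → t ≤ cap x * k x) vs → s ≤ t →
              s ≤ weightℕ vs k p → s ≤ weightℕ vs k (λ x → p x ⊓ cap x)
  weightℕ-⊓ []       p []           s≤t s≤W = s≤W
  weightℕ-⊓ {k} {cap} {s = s} (x ∷ vs) p (t≤cap ∷ t≤caps) s≤t s≤W with p x ≤? cap x
  ... | yes px≤cap rewrite m≤n⇒m⊓n≡m px≤cap =
    ≤-trans (m≤n+m∸n s (p x * k x)) (+-monoʳ-≤ (p x * k x)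
      (weightℕ-⊓ vs p t≤caps (≤-trans (m∸n≤m s (p x * k x)) s≤t) (m≤n+o⇒m∸n≤o s (p x * k x) s≤W)))
  ... | no px≰cap rewrite m≥n⇒m⊓n≡n (<⇒≤ (≰⇒> px≰cap)) =
    ≤-trans s≤t (≤-trans t≤cap (m≤m+n (cap x * k x) _))

  module Tables {n} (index : Vertex → Fin n) (index-injective : ∀ {x y} → index x ≡ index y → x ≡ y) where

    config : Vec ℕ n → Config Vertex
    config t x = lookup t (index x)

    moveᵗ : Vec ℕ n → Vertex → Vertex → Vec ℕ n
    moveᵗ t u v = (t [ index v ]≔ (config t v + 1)) [ index u ]≔ (config t u ∸ 2)

    config-moveᵗ : ∀ t u v → config (moveᵗ t u v) ≗ move (config t) u v
    config-moveᵗ t u v x with x ≟ u | x ≟ v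
    ... | yes refl | _        = lookup∘update (index x) (t [ index v ]≔ (config t v + 1)) (config t x ∸ 2)
    ... | no x≢u   | yes refl =
      trans (lookup∘update′ (x≢u ∘ index-injective) (t [ index x ]≔ (config t x + 1)) (config t u ∸ 2))
            (lookup∘update (index x) t (config t x + 1))
    ... | no x≢u   | no x≢v   =
      trans (lookup∘update′ (x≢u ∘ index-injective) (t [ index v ]≔ (config t v + 1)) (config t u ∸ 2))
            (lookup∘update′ (x≢v ∘ index-injective) t (config t v + 1))

    module Certificates (edge? : Decidable Edge) where

      solves : Vertex → Vec ℕ n → List (Vertex × Vertex) → Bool
      solves s t []             = 1 ≤ᵇ config t s
      solves s t ((u , v) ∷ ms) = does (edge? u v) ∧ (2 ≤ᵇ config t u) ∧ solves s (moveᵗ t u v) ms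

      solves-sound : ∀ s t ms → T (solves s t ms) → Solvable s (config t)
      solves-sound s t []             ok = config t , done , ≤ᵇ⇒≤ 1 (config t s) ok
      solves-sound s t ((u , v) ∷ ms) ok with edge? u v | 2 ≤ᵇ config t u in 2≤ᵇtu
      ... | yes uv | true
        with s′ , reach , 1≤s′ ← Solvable-mono (≤-reflexive ∘ config-moveᵗ t u v) (solves-sound s (moveᵗ t u v) ms ok) =
        s′ , step u v uv (≤ᵇ⇒≤ 2 (config t u) (Equivalence.from T-≡ 2≤ᵇtu)) reach , 1≤s′

pad : ∀ n → List ℕ → Vec ℕ n
pad zero    _        = []
pad (suc n) []       = 0 ∷ pad n []
pad (suc n) (a ∷ as) = a ∷ pad n as

pad-toList : ∀ {n} (t : Vec ℕ n) → pad n (toList t) ≡ t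
pad-toList []      = refl
pad-toList (a ∷ t) = cong (a ∷_) (pad-toList t)

lookup-pad-++ : ∀ n as bs i → lookup (pad n as) i ≤ lookup (pad n (as ++ bs)) i
lookup-pad-++ (suc n) []       bs       zero    = z≤n
lookup-pad-++ (suc n) []       []       (suc i) = lookup-pad-++ n [] [] i
lookup-pad-++ (suc n) []       (b ∷ bs) (suc i) = lookup-pad-++ n [] bs i
lookup-pad-++ (suc n) (a ∷ as) bs       zero    = ≤-refl
lookup-pad-++ (suc n) (a ∷ as) bs       (suc i) = lookup-pad-++ n as bs i

-- hit and light are ordinary parameters, not arguments of a module application: otherwise the
-- type of capped-configurations-checked and the hypothesis of search-sound mention different
-- copies of search, and Agda re-runs the whole search to compare them.
module _ (hit light : List ℕ → Bool) where

  search : List ℕ → List ℕ → Bool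
  search pre []       = hit pre ∨ light pre
  search pre (c ∷ cs) = hit pre ∨ all (λ a → search (pre ∷ʳ a) cs) (upTo (suc c))

  module _ {P : List ℕ → Set} (P-++ : ∀ as bs → P as → P (as ++ bs)) (hit-sound : ∀ as → T (hit as) → P as) where

    search-sound : ∀ pre {as cs} → Pointwise _≤_ as cs → search pre cs ≡ true →
                   P (pre ++ as) ⊎ T (light (pre ++ as))
    search-sound pre [] ok with Equivalence.to T-∨ (Equivalence.from T-≡ ok)
    ... | inj₁ h = inj₁ (P-++ pre [] (hit-sound pre h))
    ... | inj₂ l = inj₂ (subst (T ∘ light) (sym (++-identityʳ pre)) l)
    search-sound pre {a ∷ as} (a≤c ∷ as≤cs) ok with Equivalence.to T-∨ (Equivalence.from T-≡ ok)
    ... | inj₁ h = inj₁ (P-++ pre (a ∷ as) (hit-sound pre h))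
    ... | inj₂ h = subst (λ l → P l ⊎ T (light l)) (++-assoc pre [ a ] as)
      (search-sound (pre ∷ʳ a) as≤cs (Equivalence.to T-≡ (All.lookup (all⁺ _ _ h) (∈-upTo⁺ (s≤s a≤c)))))

open Defs
open PebblingProperties _≟V_ Adj

u x₁ x₂ x₃ y₁₂ y₁₃ y₂₃ z : V
u   = q false false false
x₁  = q true  false false
x₂  = q false true  false
x₃  = q false false true
y₁₂ = q true  true  false
y₁₃ = q true  false true
y₂₃ = q false true  true
z   = q true  true  true

cube : List V
cube = u ∷ x₁ ∷ x₂ ∷ x₃ ∷ y₁₂ ∷ y₁₃ ∷ y₂₃ ∷ z ∷ []

vertices : Vec V 9
vertices = r ∷ fromList cube

index : V → Fin 9
index r                     = # 0
index (q false false false) = # 1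
index (q true  false false) = # 2
index (q false true  false) = # 3
index (q false false true ) = # 4
index (q true  true  false) = # 5
index (q true  false true ) = # 6
index (q false true  true ) = # 7
index (q true  true  true ) = # 8

lookup-index : ∀ x → lookup vertices (index x) ≡ x
lookup-index r                     = refl
lookup-index (q false false false) = refl
lookup-index (q true  false false) = refl
lookup-index (q false true  false) = refl
lookup-index (q false false true ) = refl
lookup-index (q true  true  false) = refl
lookup-index (q true  false true ) = refl
lookup-index (q false true  true ) = refl
lookup-index (q true  true  true ) = refl

index-injective : ∀ {x y} → index x ≡ index y → x ≡ y
index-injective {x} {y} eq = trans (sym (lookup-index x)) (trans (cong (lookup vertices) eq) (lookup-index y))

open Tables index index-injective

config-pad-map : ∀ g → config (pad 9 (List.map g allV)) ≗ g
config-pad-map g x = begin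
  lookup (pad 9 (toList (Vec.map g vertices))) (index x)
    ≡⟨ cong (λ t → lookup t (index x)) (pad-toList (Vec.map g vertices)) ⟩
  lookup (Vec.map g vertices) (index x)
    ≡⟨ lookup-map (index x) g vertices ⟩
  g (lookup vertices (index x))
    ≡⟨ cong g (lookup-index x) ⟩
  g x ∎
  where open ≡-Reasoning

adjacent? : Decidable Adj
adjacent? r         r            = no λ ()
adjacent? r         (q a b c)    = q a b c ≟V u
adjacent? (q a b c) r            = q a b c ≟V u
adjacent? (q a b c) (q a′ b′ c′) = diffB a a′ + diffB b b′ + diffB c c′ ℕ.≟ 1

open Certificates adjacent?

wℕ : V → ℕ
wℕ r = 0
wℕ (q a b c) with ones a b c
... | 0 = 12
... | 1 = 6
... | 2 = 4
... | _ = 3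

3w≡wℕ : ∀ v → toℚ 3 *ℚ w v ≡ toℚ (wℕ v)
3w≡wℕ r = refl
3w≡wℕ (q a b c) with ones a b c
... | 0                 = refl
... | 1                 = refl
... | 2                 = refl
... | suc (suc (suc _)) = refl

w-nonneg : ∀ v → 0ℚ ≤ℚ w v
w-nonneg r = *≤* (+≤+ z≤n)
w-nonneg (q a b c) with ones a b c
... | 0                 = *≤* (+≤+ z≤n)
... | 1                 = *≤* (+≤+ z≤n)
... | 2                 = *≤* (+≤+ z≤n)
... | suc (suc (suc _)) = *≤* (+≤+ z≤n)

w≡0⇒r : ∀ v → w v ≡ 0ℚ → v ≡ r
w≡0⇒r r _ = refl
w≡0⇒r (q a b c) with ones a b c
... | 0                 = λ ()
... | 1                 = λ ()
... | 2                 = λ ()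
... | suc (suc (suc _)) = λ ()

weightℕ-allV : ∀ p → weightℕ allV wℕ p ≡ weightℕ cube wℕ p
weightℕ-allV p = cong (_+ weightℕ cube wℕ p) (*-zeroʳ (p r))

cap : V → ℕ
cap r         = 0
cap (q a b c) = 4 * suc (ones a b c)

46≤cap*wℕ : All (λ x → 46 ≤ cap x * wℕ x) cube
46≤cap*wℕ = toWitness {a? = all? (λ x → 46 ≤? cap x * wℕ x) cube} _

capped-heavy : ∀ p → 46 ≤ weightℕ allV wℕ p → 46 ≤ weightℕ allV wℕ (λ x → p x ⊓ cap x)
capped-heavy p heavy = subst (46 ≤_) (sym (weightℕ-allV (λ x → p x ⊓ cap x)))
  (weightℕ-⊓ {wℕ} {cap} cube p 46≤cap*wℕ ≤-refl (subst (46 ≤_) (weightℕ-allV p) heavy))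

isOdd : ℕ → Bool
isOdd n = n % 2 ≡ᵇ 1

preferOdd : Vec ℕ 9 → V → List V → V
preferOdd t v vs = fromMaybe v (findᵇ (isOdd ∘ config t) (v ∷ vs))

-- An entry (s , v , vs) moves every pair of pebbles off s, each time to the first vertex of
-- v ∷ vs holding an odd number of pebbles (completing a pair there), or to v if there is none.
pushDown : List (V × V × List V) → Vec ℕ 9 → List (V × V)
pushDown []                    t = []
pushDown ((s , v , vs) ∷ plan) t = drain (config t s / 2) t
  where
  drain : ℕ → Vec ℕ 9 → List (V × V)
  drain zero    t = pushDown plan t
  drain (suc k) t = let v′ = preferOdd t v vs in (s , v′) ∷ drain k (moveᵗ t s v′)

lowerLevels : List (V × V × List V)
lowerLevels = (y₁₃ , x₁ , x₃ ∷ []) ∷ (y₁₂ , x₁ , x₂ ∷ [])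
            ∷ (x₃ , u , []) ∷ (x₂ , u , []) ∷ (x₁ , u , []) ∷ (u , r , []) ∷ []

-- Neither plan alone handles every capped configuration; the two together do.
plan₁ plan₂ : List (V × V × List V)
plan₁ = (z , y₁₂ , y₁₃ ∷ y₂₃ ∷ []) ∷ (y₂₃ , x₂ , x₃ ∷ []) ∷ lowerLevels
plan₂ = (z , y₁₃ , y₁₂ ∷ y₂₃ ∷ []) ∷ (y₂₃ , x₃ , x₂ ∷ []) ∷ lowerLevels

solvedByPushing : List ℕ → Bool
solvedByPushing as = solves r t (pushDown plan₁ t) ∨ solves r t (pushDown plan₂ t)
  where t = pad 9 as

solvedByPushing-sound : ∀ as → T (solvedByPushing as) → Solvable r (config (pad 9 as))
solvedByPushing-sound as ok with Equivalence.to T-∨ ok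
... | inj₁ ok₁ = solves-sound r (pad 9 as) (pushDown plan₁ (pad 9 as)) ok₁
... | inj₂ ok₂ = solves-sound r (pad 9 as) (pushDown plan₂ (pad 9 as)) ok₂

solvable-++ : ∀ as bs → Solvable r (config (pad 9 as)) → Solvable r (config (pad 9 (as ++ bs)))
solvable-++ as bs = Solvable-mono (lookup-pad-++ 9 as bs ∘ index)

light : List ℕ → Bool
light as = weightℕ allV wℕ (config (pad 9 as)) <ᵇ 46

-- Stated with _≡_ rather than T: checking refl evaluates the search far faster than checking tt.
capped-configurations-checked : search solvedByPushing light [] (List.map cap allV) ≡ true
capped-configurations-checked = refl

heavy⇒solvable : ∀ p → 46 ≤ weightℕ allV wℕ p → Solvable r p
heavy⇒solvable p heavy = [ Solvable-mono capped≤p , light-absurd ]′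
  (search-sound solvedByPushing light solvable-++ solvedByPushing-sound [] capped≤cap capped-configurations-checked)
  where
  capped : List ℕ
  capped = List.map (λ x → p x ⊓ cap x) allV
  capped≤cap : Pointwise _≤_ capped (List.map cap allV)
  capped≤cap = Pointwise.map⁺ _ _ (Pointwise.refl (λ {x} → m⊓n≤n (p x) (cap x)))
  capped≤p : config (pad 9 capped) ≤ᶜ p
  capped≤p x = ≤-trans (≤-reflexive (config-pad-map (λ x → p x ⊓ cap x) x)) (m⊓n≤m (p x) (cap x))
  light-absurd : T (light capped) → Solvable r p
  light-absurd isLight =
    contradiction (capped-heavy p heavy) (<⇒≱ (<ᵇ⇒< (weightℕ allV wℕ (λ x → p x ⊓ cap x)) 46 isLight))

lemma5 : ValidWeight allV r w
lemma5 = w-nonneg , refl , w≡0⇒r , unsolvable-weight-≤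
  where
  unsolvable-weight-≤ : ∀ p → ¬ Solvable r p → weight allV w p ≤ℚ weight allV w oneG
  unsolvable-weight-≤ p unsolvable =
    [ weight-mono-scaled 3 {w} {wℕ} 3w≡wℕ allV {p} {oneG}
    , (λ heavy → contradiction (heavy⇒solvable p heavy) unsolvable)
    ]′ (≤-<-connex (weightℕ allV wℕ p) 45)
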